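{- If $m\ge R^{(3)}(4,4,4,4,4,4,6,6)$, then there does not exist an $I(m,m-2)$ admissible set.
   Context: $R^{(k)}(n_1,\dots,n_c)$ denotes the hypergraph Ramsey number: the smallest $N$ such that for every colouring of the $k$-element subsets of $[N]=\{1,\dots,N\}$ with colours $1,\dots,c$ there is some $i$ and a subset of $[N]$ of size $n_i$ all of whose $k$-element subsets have colour $i$. For $v\in\{0,1,2\}^m$, $\mathrm{Supp}\, v=\{i: v_i\neq0\}$; $V_S$ is the set of vectors in $\{0,1,2\}^m$ with support exactly $S$. A subset of $\{0,1,2\}^m$ is $I(m,w)$ if it contains exactly one element of $V_S$ for each $S\subseteq[m]$ with $|S|=w$ and no other elements. Two vectors form a clash if the support of one is contained in that of the other; three vectors $v_1,v_2,v_3$ form a clash if there is no coordinate at which exactly one of them is non-zero and no coordinate at which their three values are pairwise distinct. A set is admissible if it contains no clash (of two distinct or three distinct elements). -}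

module Defs where

open import Data.Nat using (ℕ; _<_; _∸_)
open import Data.Fin using (Fin; zero; suc)
open import Data.Fin.Subset using (Subset; _⊆_; ∣_∣; _∈_; inside; outside)
open import Data.Vec using (Vec; []; _∷_; lookup; map)
open import Data.Bool using (Bool; true; false)
open import Data.Product using (Σ; ∃; _×_; _,_)
open import Relation.Nullary using (¬_)
open import Data.Unit using (⊤)
open import Data.Empty using (⊥)
open import Relation.Binary.PropositionalEquality using (_≡_; _≢_)

-- A c-colouring of the subsets of [N]; only its values on k-subsets matter.
Colouring : ℕ → ℕ → Set
Colouring N c = Subset N → Fin c

Monochromatic : ∀ {N c} (k : ℕ) → Colouring N c → Fin c → Subset N → Set
Monochromatic k χ i T = ∀ S → S ⊆ T → ∣ S ∣ ≡ k → χ S ≡ i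

RamseyProperty : (k : ℕ) {c : ℕ} → Vec ℕ c → ℕ → Set
RamseyProperty k {c} ns N =
  (χ : Colouring N c) →
  Σ (Fin c) λ i → Σ (Subset N) λ T → (∣ T ∣ ≡ lookup ns i) × Monochromatic k χ i T

IsRamseyNumber : (k : ℕ) {c : ℕ} → Vec ℕ c → ℕ → Set
IsRamseyNumber k ns R = RamseyProperty k ns R × (∀ N → N < R → ¬ RamseyProperty k ns N)

Tern : ℕ → Set
Tern m = Vec (Fin 3) m

nz : Fin 3 → Bool
nz zero = false
nz (suc _) = true

Supp : ∀ {m} → Tern m → Subset m
Supp v = map (λ x → if′ x) v
  where
  if′ : Fin 3 → Bool
  if′ zero = outside
  if′ (suc _) = inside

TernSet : ℕ → Set
TernSet m = Tern m → Bool

_∈ₜ_ : ∀ {m} → Tern m → TernSet m → Set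
v ∈ₜ A = A v ≡ true

IsI : (m w : ℕ) → TernSet m → Set
IsI m w A =
  (∀ S → ∣ S ∣ ≡ w → ∃ λ v → v ∈ₜ A × Supp v ≡ S)
  × (∀ u v → u ∈ₜ A → v ∈ₜ A → Supp u ≡ Supp v → u ≡ v)
  × (∀ v → v ∈ₜ A → ∣ Supp v ∣ ≡ w)

-- Two-element clash (ordered; symmetric case covered by swapping).
Clash2 : ∀ {m} → Tern m → Tern m → Set
Clash2 u v = Supp u ⊆ Supp v

ExactlyOneNZ : Fin 3 → Fin 3 → Fin 3 → Set
ExactlyOneNZ a b c with nz a | nz b | nz c
... | true  | false | false = ⊤
... | false | true  | false = ⊤
... | false | false | true  = ⊤
... | _ | _ | _ = ⊥

PairwiseDistinct : Fin 3 → Fin 3 → Fin 3 → Set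
PairwiseDistinct a b c = (a ≢ b) × (a ≢ c) × (b ≢ c)

Clash3 : ∀ {m} → Tern m → Tern m → Tern m → Set
Clash3 {m} u v w =
  (∀ (j : Fin m) → ¬ ExactlyOneNZ (lookup u j) (lookup v j) (lookup w j))
  × (∀ (j : Fin m) → ¬ PairwiseDistinct (lookup u j) (lookup v j) (lookup w j))

Admissible : ∀ {m} → TernSet m → Set
Admissible A =
  (∀ u v → u ∈ₜ A → v ∈ₜ A → u ≢ v → ¬ Clash2 u v)
  × (∀ u v w → u ∈ₜ A → v ∈ₜ A → w ∈ₜ A → u ≢ v → u ≢ w → v ≢ w → ¬ Clash3 u v w)

{-# OPTIONS --safe #-}
module Submission where

-- For a < b let V a b be the element of A whose support misses exactly a and b;
-- its other entries are 1 or 2. Colour each triple x < y < z of coordinates by its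
-- profile (V y z at x, V x z at y, V x y at z) ∈ {1,2}³. Three vectors clash as soon
-- as, wherever one of them vanishes, the other two agree. By the Ramsey property there
-- are either four coordinates whose triples share a profile t with t₁ = t₂ or t₂ = t₃,
-- and then three of the V's through a common point (a star) satisfy this, or six
-- coordinates sharing an alternating profile, and then V a b, V c d, V e f do.
-- Either way A contains a 3-clash.

open import Defs
open import Data.Empty using (⊥-elim)
open import Data.Fin using (Fin; zero; suc; _<_; inject≤; #_)
open import Data.Fin.Properties using (<-trans; <-asym; <⇒≢; _<?_; toℕ-inject≤)
open import Data.Fin.Subset using (Subset; _⊆_; ∣_∣; _∈_; _∉_; inside; outside; ⁅_⁆; ⋃; ∁)
open import Data.Fin.Subset.Properties
  using (x∈⁅x⁆; x∈⁅y⁆⇒x≡y; x∈p∪q⁻; x∈p∪q⁺; ∉⊥; x∈p⇒x∉∁p; x∉∁p⇒x∈p; ∣∁p∣≡n∸∣p∣)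
open import Data.List using (List; []; _∷_; map; length)
open import Data.List.Properties using (length-map)
open import Data.List.Membership.Propositional using () renaming (_∈_ to _∈ˡ_)
open import Data.List.Membership.Propositional.Properties using (∈-map⁺; ∈-map⁻)
open import Data.List.Relation.Binary.Subset.Propositional using () renaming (_⊆_ to _⊆ˡ_)
open import Data.List.Relation.Unary.All as All using (All; []; _∷_)
open import Data.List.Relation.Unary.All.Properties as All using ()
open import Data.List.Relation.Unary.AllPairs as AllPairs using (AllPairs; []; _∷_)
open import Data.List.Relation.Unary.AllPairs.Properties as AllPairs using ()
open import Data.List.Relation.Unary.Any using (here; there)
open import Data.Nat as ℕ using (ℕ; _≤_; _∸_; _≥_; z<s; s<s)
open import Data.Product using (Σ-syntax; ∃; _×_; _,_; proj₁; proj₂)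
open import Data.Sum as Sum using (_⊎_; inj₁; inj₂)
open import Data.Vec using (Vec; []; _∷_; lookup; replicate; toList; fromList; here; there)
open import Data.Vec.Properties using (toList∘fromList)
open import Level using (Level)
open import Relation.Binary.Definitions using (Asymmetric)
open import Relation.Binary.Core using (Rel)
open import Relation.Binary.PropositionalEquality
open import Relation.Nullary using (¬_; yes; no; contradiction)

private
  variable
    a ℓ : Level
    A : Set a
    k m n : ℕ

>⇒≢ : {i j : Fin n} → j < i → i ≢ j
>⇒≢ j<i i≡j = <⇒≢ j<i (sym i≡j)

AllPairs-asym-⊆-⊇⇒≡ : {_≺_ : Rel A ℓ} → Asymmetric _≺_ → {xs ys : List A} →
  AllPairs _≺_ xs → AllPairs _≺_ ys → xs ⊆ˡ ys → ys ⊆ˡ xs → xs ≡ ys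
AllPairs-asym-⊆-⊇⇒≡ _ [] [] _ _ = refl
AllPairs-asym-⊆-⊇⇒≡ _ [] (_ ∷ _) _ ys⊆xs with ys⊆xs (here refl)
... | ()
AllPairs-asym-⊆-⊇⇒≡ _ (_ ∷ _) [] xs⊆ys _ with xs⊆ys (here refl)
... | ()
AllPairs-asym-⊆-⊇⇒≡ {_≺_ = _≺_} asym {x ∷ xs} {y ∷ ys} (x≺xs ∷ sorted-xs) (y≺ys ∷ sorted-ys) ⊆ ⊇ =
  cong₂ _∷_ x≡y (AllPairs-asym-⊆-⊇⇒≡ asym sorted-xs sorted-ys xs⊆ys ys⊆xs)
  where
  irrefl : ∀ {z} → ¬ (z ≺ z)
  irrefl z≺z = asym z≺z z≺z

  x≡y : x ≡ y
  x≡y with ⊆ (here refl) | ⊇ (here refl)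
  ... | here x≡y | _ = x≡y
  ... | there _ | here y≡x = sym y≡x
  ... | there x∈ys | there y∈xs = ⊥-elim (asym (All.lookup y≺ys x∈ys) (All.lookup x≺xs y∈xs))

  xs⊆ys : xs ⊆ˡ ys
  xs⊆ys z∈xs with ⊆ (there z∈xs)
  ... | there z∈ys = z∈ys
  ... | here refl = ⊥-elim (irrefl (subst (_≺ _) x≡y (All.lookup x≺xs z∈xs)))

  ys⊆xs : ys ⊆ˡ xs
  ys⊆xs z∈ys with ⊇ (there z∈ys)
  ... | there z∈xs = z∈xs
  ... | here refl = ⊥-elim (irrefl (subst (_≺ _) (sym x≡y) (All.lookup y≺ys z∈ys)))

-- Subsets of Fin n as strictly increasing lists

elements : Subset n → List (Fin n)
elements [] = []
elements (inside ∷ p) = zero ∷ map suc (elements p)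
elements (outside ∷ p) = map suc (elements p)

length-elements : (p : Subset n) → length (elements p) ≡ ∣ p ∣
length-elements [] = refl
length-elements (inside ∷ p) = cong ℕ.suc (trans (length-map suc (elements p)) (length-elements p))
length-elements (outside ∷ p) = trans (length-map suc (elements p)) (length-elements p)

elements-sorted : (p : Subset n) → AllPairs _<_ (elements p)
elements-sorted [] = []
elements-sorted (inside ∷ p) =
  All.map⁺ (All.universal (λ _ → z<s) (elements p))
    ∷ AllPairs.map⁺ (AllPairs.map s<s (elements-sorted p))
elements-sorted (outside ∷ p) = AllPairs.map⁺ (AllPairs.map s<s (elements-sorted p))

∈-elements⁻ : (p : Subset n) {i : Fin n} → i ∈ˡ elements p → i ∈ p
∈-elements⁻ (inside ∷ p) (here refl) = here
∈-elements⁻ (inside ∷ p) (there i∈) with ∈-map⁻ suc i∈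
... | _ , j∈ , refl = there (∈-elements⁻ p j∈)
∈-elements⁻ (outside ∷ p) i∈ with ∈-map⁻ suc i∈
... | _ , j∈ , refl = there (∈-elements⁻ p j∈)

∈-elements⁺ : (p : Subset n) {i : Fin n} → i ∈ p → i ∈ˡ elements p
∈-elements⁺ (inside ∷ p) here = here refl
∈-elements⁺ (inside ∷ p) (there i∈) = there (∈-map⁺ suc (∈-elements⁺ p i∈))
∈-elements⁺ (outside ∷ p) (there i∈) = ∈-map⁺ suc (∈-elements⁺ p i∈)

toSubset : List (Fin n) → Subset n
toSubset xs = ⋃ (map ⁅_⁆ xs)

∈-toSubset⁻ : (xs : List (Fin n)) {i : Fin n} → i ∈ toSubset xs → i ∈ˡ xs
∈-toSubset⁻ [] i∈ = ⊥-elim (∉⊥ i∈)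
∈-toSubset⁻ (x ∷ xs) i∈ with x∈p∪q⁻ ⁅ x ⁆ (toSubset xs) i∈
... | inj₁ i∈⁅x⁆ = here (x∈⁅y⁆⇒x≡y x i∈⁅x⁆)
... | inj₂ i∈xs = there (∈-toSubset⁻ xs i∈xs)

∈-toSubset⁺ : (xs : List (Fin n)) {i : Fin n} → i ∈ˡ xs → i ∈ toSubset xs
∈-toSubset⁺ (x ∷ xs) (here refl) = x∈p∪q⁺ (inj₁ (x∈⁅x⁆ x))
∈-toSubset⁺ (x ∷ xs) (there i∈) = x∈p∪q⁺ {p = ⁅ x ⁆} (inj₂ (∈-toSubset⁺ xs i∈))

toSubset-⊆ : {xs : List (Fin n)} {p : Subset n} → All (_∈ p) xs → toSubset xs ⊆ p
toSubset-⊆ {xs = xs} xs∈p i∈ = All.lookup xs∈p (∈-toSubset⁻ xs i∈)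

elements-toSubset : {xs : List (Fin n)} → AllPairs _<_ xs → elements (toSubset xs) ≡ xs
elements-toSubset {xs = xs} sorted =
  AllPairs-asym-⊆-⊇⇒≡ <-asym (elements-sorted (toSubset xs)) sorted
  (λ i∈ → ∈-toSubset⁻ xs (∈-elements⁻ (toSubset xs) i∈))
  (λ i∈ → ∈-elements⁺ (toSubset xs) (∈-toSubset⁺ xs i∈))

∣toSubset∣ : {xs : List (Fin n)} → AllPairs _<_ xs → ∣ toSubset xs ∣ ≡ length xs
∣toSubset∣ {xs = xs} sorted =
  trans (sym (length-elements (toSubset xs))) (cong length (elements-toSubset sorted))

toVec : (xs : List A) → length xs ≡ k → Σ[ v ∈ Vec A k ] toList v ≡ xs
toVec xs refl = fromList xs , toList∘fromList xs

enumerate : (p : Subset n) → ∣ p ∣ ≡ k →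
  Σ[ xs ∈ Vec (Fin n) k ] AllPairs _<_ (toList xs) × All (_∈ p) (toList xs)
enumerate p ∣p∣≡k with toVec (elements p) (trans (length-elements p) ∣p∣≡k)
... | xs , xs≡elements =
  xs , subst (AllPairs _<_) (sym xs≡elements) (elements-sorted p)
     , subst (All (_∈ p)) (sym xs≡elements) (All.tabulate (∈-elements⁻ p))

onSortedTriples : {c : ℕ} → (Fin n → Fin n → Fin n → Fin (ℕ.suc c)) → Colouring n (ℕ.suc c)
onSortedTriples f S with elements S
... | x ∷ y ∷ z ∷ [] = f x y z
... | _ = zero

onSortedTriples-toSubset : {c : ℕ} (f : Fin n → Fin n → Fin n → Fin (ℕ.suc c)) {x y z : Fin n} →
  AllPairs _<_ (x ∷ y ∷ z ∷ []) → onSortedTriples f (toSubset (x ∷ y ∷ z ∷ [])) ≡ f x y z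
onSortedTriples-toSubset f sorted rewrite elements-toSubset sorted = refl

onSortedTriples-monochromatic : {c : ℕ} {f : Fin n → Fin n → Fin n → Fin (ℕ.suc c)}
  {i : Fin (ℕ.suc c)} {T : Subset n} → Monochromatic 3 (onSortedTriples f) i T →
  {x y z : Fin n} → x < y → y < z → x ∈ T → y ∈ T → z ∈ T → f x y z ≡ i
onSortedTriples-monochromatic {f = f} {i} mono {x} {y} {z} x<y y<z x∈T y∈T z∈T = begin
  f x y z               ≡⟨ onSortedTriples-toSubset f sorted ⟨
  onSortedTriples f xyz ≡⟨ mono xyz (toSubset-⊆ (x∈T ∷ y∈T ∷ z∈T ∷ [])) (∣toSubset∣ sorted) ⟩
  i                     ∎
  where
  open ≡-Reasoning
  sorted : AllPairs _<_ (x ∷ y ∷ z ∷ [])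
  sorted = (x<y ∷ <-trans x<y y<z ∷ []) ∷ (y<z ∷ []) ∷ [] ∷ []
  xyz : Subset _
  xyz = toSubset (x ∷ y ∷ z ∷ [])

-- Clashes

data ClashColumn : Fin 3 → Fin 3 → Fin 3 → Set where
  nonzero : ∀ {x y z} → ClashColumn (suc x) (suc y) (suc z)
  zero₁   : ∀ {y} → ClashColumn zero y y
  zero₂   : ∀ {x} → ClashColumn x zero x
  zero₃   : ∀ {x} → ClashColumn x x zero

ClashColumn⇒¬ExactlyOneNZ : ∀ {x y z} → ClashColumn x y z → ¬ ExactlyOneNZ x y z
ClashColumn⇒¬ExactlyOneNZ nonzero = λ ()
ClashColumn⇒¬ExactlyOneNZ (zero₁ {zero}) = λ ()
ClashColumn⇒¬ExactlyOneNZ (zero₁ {suc _}) = λ ()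
ClashColumn⇒¬ExactlyOneNZ (zero₂ {zero}) = λ ()
ClashColumn⇒¬ExactlyOneNZ (zero₂ {suc _}) = λ ()
ClashColumn⇒¬ExactlyOneNZ (zero₃ {zero}) = λ ()
ClashColumn⇒¬ExactlyOneNZ (zero₃ {suc _}) = λ ()

¬PairwiseDistinct-Fin2 : (x y z : Fin 2) → ¬ PairwiseDistinct (suc x) (suc y) (suc z)
¬PairwiseDistinct-Fin2 zero zero _ (x≢y , _) = x≢y refl
¬PairwiseDistinct-Fin2 (suc zero) (suc zero) _ (x≢y , _) = x≢y refl
¬PairwiseDistinct-Fin2 zero (suc zero) zero (_ , x≢z , _) = x≢z refl
¬PairwiseDistinct-Fin2 (suc zero) zero (suc zero) (_ , x≢z , _) = x≢z refl
¬PairwiseDistinct-Fin2 zero (suc zero) (suc zero) (_ , _ , y≢z) = y≢z refl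
¬PairwiseDistinct-Fin2 (suc zero) zero zero (_ , _ , y≢z) = y≢z refl

ClashColumn⇒¬PairwiseDistinct : ∀ {x y z} → ClashColumn x y z → ¬ PairwiseDistinct x y z
ClashColumn⇒¬PairwiseDistinct (nonzero {x} {y} {z}) = ¬PairwiseDistinct-Fin2 x y z
ClashColumn⇒¬PairwiseDistinct zero₁ (_ , _ , y≢y) = y≢y refl
ClashColumn⇒¬PairwiseDistinct zero₂ (_ , x≢x , _) = x≢x refl
ClashColumn⇒¬PairwiseDistinct zero₃ (x≢x , _ , _) = x≢x refl

agreement⇒ClashColumn : ∀ {x y z} →
  (x ≡ zero → y ≡ z) → (y ≡ zero → x ≡ z) → (z ≡ zero → x ≡ y) → ClashColumn x y z
agreement⇒ClashColumn {zero} y≡z _ _ with y≡z refl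
... | refl = zero₁
agreement⇒ClashColumn {suc _} {zero} _ x≡z _ with x≡z refl
... | refl = zero₂
agreement⇒ClashColumn {suc _} {suc _} {zero} _ _ x≡y with x≡y refl
... | refl = zero₃
agreement⇒ClashColumn {suc _} {suc _} {suc _} _ _ _ = nonzero

record AgreeOnZerosOf (u v w : Tern m) : Set where
  constructor agreeing
  field agree : ∀ j → lookup u j ≡ zero → lookup v j ≡ lookup w j

agreement⇒Clash3 : {u v w : Tern m} →
  AgreeOnZerosOf u v w → AgreeOnZerosOf v u w → AgreeOnZerosOf w u v → Clash3 u v w
agreement⇒Clash3 (agreeing agree-u) (agreeing agree-v) (agreeing agree-w) =
  (λ j → ClashColumn⇒¬ExactlyOneNZ (column j)) , (λ j → ClashColumn⇒¬PairwiseDistinct (column j))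
  where
  column : ∀ j → ClashColumn _ _ _
  column j = agreement⇒ClashColumn (agree-u j) (agree-v j) (agree-w j)

record VanishesExactlyAt (u : Tern m) (a b : Fin m) : Set where
  field
    vanishes₁ : lookup u a ≡ zero
    vanishes₂ : lookup u b ≡ zero
    only      : ∀ j → lookup u j ≡ zero → j ≡ a ⊎ j ≡ b

open VanishesExactlyAt

swap : {u : Tern m} {a b : Fin m} → VanishesExactlyAt u a b → VanishesExactlyAt u b a
swap z = record
  { vanishes₁ = vanishes₂ z
  ; vanishes₂ = vanishes₁ z
  ; only      = λ j uj≡0 → Sum.swap (only z j uj≡0)
  }

agreeOnZerosOf : {u v w : Tern m} {a b : Fin m} → VanishesExactlyAt u a b →
  lookup v a ≡ lookup w a → lookup v b ≡ lookup w b → AgreeOnZerosOf u v w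
agreeOnZerosOf {u = u} {v} {w} z va≡wa vb≡wb = agreeing agree
  where
  agree : ∀ j → lookup u j ≡ zero → lookup v j ≡ lookup w j
  agree j uj≡0 with only z j uj≡0
  ... | inj₁ refl = va≡wa
  ... | inj₂ refl = vb≡wb

star⇒Clash3 : {u v w : Tern m} {c a₁ a₂ a₃ : Fin m} →
  VanishesExactlyAt u c a₁ → VanishesExactlyAt v c a₂ → VanishesExactlyAt w c a₃ →
  lookup v a₁ ≡ lookup w a₁ → lookup u a₂ ≡ lookup w a₂ → lookup u a₃ ≡ lookup v a₃ →
  Clash3 u v w
star⇒Clash3 zu zv zw e₁ e₂ e₃ = agreement⇒Clash3
  (agreeOnZerosOf zu (both-zero zv zw) e₁)
  (agreeOnZerosOf zv (both-zero zu zw) e₂)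
  (agreeOnZerosOf zw (both-zero zu zv) e₃)
  where
  both-zero : ∀ {u v : Tern _} {c a b} → VanishesExactlyAt u c a → VanishesExactlyAt v c b →
    lookup u c ≡ lookup v c
  both-zero zu zv = trans (vanishes₁ zu) (sym (vanishes₁ zv))

matching⇒Clash3 : {u v w : Tern m} {a₁ b₁ a₂ b₂ a₃ b₃ : Fin m} →
  VanishesExactlyAt u a₁ b₁ → VanishesExactlyAt v a₂ b₂ → VanishesExactlyAt w a₃ b₃ →
  lookup v a₁ ≡ lookup w a₁ → lookup v b₁ ≡ lookup w b₁ →
  lookup u a₂ ≡ lookup w a₂ → lookup u b₂ ≡ lookup w b₂ →
  lookup u a₃ ≡ lookup v a₃ → lookup u b₃ ≡ lookup v b₃ →
  Clash3 u v w
matching⇒Clash3 zu zv zw e₁ f₁ e₂ f₂ e₃ f₃ = agreement⇒Clash3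
  (agreeOnZerosOf zu e₁ f₁) (agreeOnZerosOf zv e₂ f₂) (agreeOnZerosOf zw e₃ f₃)

∉Supp⇒≡0 : (v : Tern m) {j : Fin m} → j ∉ Supp v → lookup v j ≡ zero
∉Supp⇒≡0 (zero ∷ v) {zero} _ = refl
∉Supp⇒≡0 (suc _ ∷ v) {zero} j∉ = contradiction here j∉
∉Supp⇒≡0 (_ ∷ v) {suc j} j∉ = ∉Supp⇒≡0 v (λ j∈ → j∉ (there j∈))

≡0⇒∉Supp : (v : Tern m) {j : Fin m} → lookup v j ≡ zero → j ∉ Supp v
≡0⇒∉Supp (zero ∷ v) {zero} _ ()
≡0⇒∉Supp (suc _ ∷ v) {zero} () _
≡0⇒∉Supp (_ ∷ v) {suc j} vj≡0 (there j∈) = ≡0⇒∉Supp v vj≡0 j∈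

pair : Fin m → Fin m → Subset m
pair a b = toSubset (a ∷ b ∷ [])

Supp≡∁pair⇒VanishesExactlyAt : {v : Tern m} {a b : Fin m} →
  Supp v ≡ ∁ (pair a b) → VanishesExactlyAt v a b
Supp≡∁pair⇒VanishesExactlyAt {v = v} {a} {b} supp = record
  { vanishes₁ = vanishes (here refl)
  ; vanishes₂ = vanishes (there (here refl))
  ; only      = only′
  }
  where
  vanishes : ∀ {j} → j ∈ˡ a ∷ b ∷ [] → lookup v j ≡ zero
  vanishes j∈ab = ∉Supp⇒≡0 v λ j∈Supp →
    x∈p⇒x∉∁p (∈-toSubset⁺ (a ∷ b ∷ []) j∈ab) (subst (_ ∈_) supp j∈Supp)

  only′ : ∀ j → lookup v j ≡ zero → j ≡ a ⊎ j ≡ b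
  only′ j vj≡0 with ∈-toSubset⁻ (a ∷ b ∷ [])
    (x∉∁p⇒x∈p λ j∈∁ → ≡0⇒∉Supp v vj≡0 (subst (j ∈_) (sym supp) j∈∁))
  ... | here j≡a = inj₁ j≡a
  ... | there (here j≡b) = inj₂ j≡b

record Profile : Set where
  constructor ⟨_,_,_⟩
  field
    first second third : Fin 3

open Profile

pattern one = suc zero
pattern two = suc (suc zero)

-- The six profiles with first ≡ second or second ≡ third get the colours whose
-- Ramsey target is 4, the two alternating ones the colours with target 6.
-- Profiles containing a zero never occur as profiles of sorted triples.
code : Profile → Fin 8
code ⟨ one , one , one ⟩ = # 0
code ⟨ two , two , two ⟩ = # 1
code ⟨ one , one , two ⟩ = # 2
code ⟨ two , two , one ⟩ = # 3
code ⟨ two , one , one ⟩ = # 4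
code ⟨ one , two , two ⟩ = # 5
code ⟨ one , two , one ⟩ = # 6
code ⟨ two , one , two ⟩ = # 7
code _                   = # 0

decode : Fin 8 → Profile
decode = lookup
  ( ⟨ one , one , one ⟩ ∷ ⟨ two , two , two ⟩ ∷ ⟨ one , one , two ⟩ ∷ ⟨ two , two , one ⟩
  ∷ ⟨ two , one , one ⟩ ∷ ⟨ one , two , two ⟩ ∷ ⟨ one , two , one ⟩ ∷ ⟨ two , one , two ⟩ ∷ [])

decode-code : {x y z : Fin 3} → x ≢ zero → y ≢ zero → z ≢ zero →
  decode (code ⟨ x , y , z ⟩) ≡ ⟨ x , y , z ⟩
decode-code {zero} x≢0 _ _ = contradiction refl x≢0
decode-code {_} {zero} _ y≢0 _ = contradiction refl y≢0
decode-code {_} {_} {zero} _ _ z≢0 = contradiction refl z≢0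
decode-code {one} {one} {one} _ _ _ = refl
decode-code {two} {two} {two} _ _ _ = refl
decode-code {one} {one} {two} _ _ _ = refl
decode-code {two} {two} {one} _ _ _ = refl
decode-code {two} {one} {one} _ _ _ = refl
decode-code {one} {two} {two} _ _ _ = refl
decode-code {one} {two} {one} _ _ _ = refl
decode-code {two} {one} {two} _ _ _ = refl

module _ {m : ℕ} {A : TernSet m} (isI : IsI m (m ∸ 2) A) (admissible : Admissible A) where

  ∣∁pair∣ : {a b : Fin m} → a < b → ∣ ∁ (pair a b) ∣ ≡ m ∸ 2
  ∣∁pair∣ {a} {b} a<b =
    trans (∣∁p∣≡n∸∣p∣ (pair a b)) (cong (m ∸_) (∣toSubset∣ ((a<b ∷ []) ∷ [] ∷ [])))

  -- A junk value unless a < b.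
  V : Fin m → Fin m → Tern m
  V a b with a <? b
  ... | yes a<b = proj₁ (proj₁ isI (∁ (pair a b)) (∣∁pair∣ a<b))
  ... | no _    = replicate m zero

  V-spec : {a b : Fin m} → a < b → V a b ∈ₜ A × Supp (V a b) ≡ ∁ (pair a b)
  V-spec {a} {b} a<b with a <? b
  ... | yes a<b′ = proj₂ (proj₁ isI (∁ (pair a b)) (∣∁pair∣ a<b′))
  ... | no a≮b   = contradiction a<b a≮b

  V∈A : {a b : Fin m} → a < b → V a b ∈ₜ A
  V∈A a<b = proj₁ (V-spec a<b)

  V-vanishes : {a b : Fin m} → a < b → VanishesExactlyAt (V a b) a b
  V-vanishes a<b = Supp≡∁pair⇒VanishesExactlyAt (proj₂ (V-spec a<b))

  V-nonzero : {a b x : Fin m} → a < b → x ≢ a → x ≢ b → lookup (V a b) x ≢ zero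
  V-nonzero a<b x≢a x≢b Vx≡0 = Sum.[ x≢a , x≢b ] (only (V-vanishes a<b) _ Vx≡0)

  V-≢ˡ : {a b c d : Fin m} → a < b → c < d → a ≢ c → a ≢ d → V a b ≢ V c d
  V-≢ˡ {a} a<b c<d a≢c a≢d Vab≡Vcd =
    V-nonzero c<d a≢c a≢d (subst (λ v → lookup v a ≡ zero) Vab≡Vcd (vanishes₁ (V-vanishes a<b)))

  V-≢ʳ : {a b c d : Fin m} → a < b → c < d → b ≢ c → b ≢ d → V a b ≢ V c d
  V-≢ʳ {b = b} a<b c<d b≢c b≢d Vab≡Vcd =
    V-nonzero c<d b≢c b≢d (subst (λ v → lookup v b ≡ zero) Vab≡Vcd (vanishes₂ (V-vanishes a<b)))

  V-¬Clash3 : {a b c d e f : Fin m} → a < b → c < d → e < f →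
    V a b ≢ V c d → V a b ≢ V e f → V c d ≢ V e f → ¬ Clash3 (V a b) (V c d) (V e f)
  V-¬Clash3 a<b c<d e<f = proj₂ admissible _ _ _ (V∈A a<b) (V∈A c<d) (V∈A e<f)

  profile : Fin m → Fin m → Fin m → Profile
  profile x y z = ⟨ lookup (V y z) x , lookup (V x z) y , lookup (V x y) z ⟩

  decode-code-profile : {x y z : Fin m} → x < y → y < z →
    decode (code (profile x y z)) ≡ profile x y z
  decode-code-profile x<y y<z = decode-code
    (V-nonzero y<z (<⇒≢ x<y) (<⇒≢ x<z))
    (V-nonzero x<z (>⇒≢ x<y) (<⇒≢ y<z))
    (V-nonzero x<y (>⇒≢ x<z) (>⇒≢ y<z))
    where
    x<z : _ < _
    x<z = <-trans x<y y<z

  Homogeneous : Profile → (Fin m → Set) → Set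
  Homogeneous t P = ∀ {x y z} → x < y → y < z → P x → P y → P z → profile x y z ≡ t

  first≡second⇒¬homogeneous₄ : {t : Profile} {P : Fin m → Set} →
    Homogeneous t P → first t ≡ second t →
    {p q r s : Fin m} → AllPairs _<_ (p ∷ q ∷ r ∷ s ∷ []) → ¬ All P (p ∷ q ∷ r ∷ s ∷ [])
  first≡second⇒¬homogeneous₄ {t} hom t₁≡t₂ {p} {q} {r} {s}
    ((p<q ∷ p<r ∷ p<s ∷ []) ∷ (q<r ∷ q<s ∷ []) ∷ (r<s ∷ []) ∷ [] ∷ []) (p∈ ∷ q∈ ∷ r∈ ∷ s∈ ∷ []) =
    V-¬Clash3 p<r q<r r<s
      (V-≢ˡ p<r q<r (<⇒≢ p<q) (<⇒≢ p<r)) (V-≢ˡ p<r r<s (<⇒≢ p<r) (<⇒≢ p<s))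
      (V-≢ˡ q<r r<s (<⇒≢ q<r) (<⇒≢ q<s))
      (star⇒Clash3 (swap (V-vanishes p<r)) (swap (V-vanishes q<r)) (V-vanishes r<s)
        (trans (cong first pqr) (sym (cong first prs)))
        (trans (cong second pqr) (trans (sym t₁≡t₂) (sym (cong first qrs))))
        (trans (cong third prs) (sym (cong third qrs))))
    where
    pqr : profile p q r ≡ t
    pqr = hom p<q q<r p∈ q∈ r∈
    prs : profile p r s ≡ t
    prs = hom p<r r<s p∈ r∈ s∈
    qrs : profile q r s ≡ t
    qrs = hom q<r r<s q∈ r∈ s∈

  second≡third⇒¬homogeneous₄ : {t : Profile} {P : Fin m → Set} →
    Homogeneous t P → second t ≡ third t →
    {p q r s : Fin m} → AllPairs _<_ (p ∷ q ∷ r ∷ s ∷ []) → ¬ All P (p ∷ q ∷ r ∷ s ∷ [])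
  second≡third⇒¬homogeneous₄ {t} hom t₂≡t₃ {p} {q} {r} {s}
    ((p<q ∷ p<r ∷ p<s ∷ []) ∷ (q<r ∷ q<s ∷ []) ∷ (r<s ∷ []) ∷ [] ∷ []) (p∈ ∷ q∈ ∷ r∈ ∷ s∈ ∷ []) =
    V-¬Clash3 p<q q<r q<s
      (V-≢ˡ p<q q<r (<⇒≢ p<q) (<⇒≢ p<r)) (V-≢ˡ p<q q<s (<⇒≢ p<q) (<⇒≢ p<s))
      (V-≢ʳ q<r q<s (>⇒≢ q<r) (<⇒≢ r<s))
      (star⇒Clash3 (swap (V-vanishes p<q)) (V-vanishes q<r) (V-vanishes q<s)
        (trans (cong first pqr) (sym (cong first pqs)))
        (trans (cong third pqr) (trans (sym t₂≡t₃) (sym (cong second qrs))))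
        (trans (cong third pqs) (sym (cong third qrs))))
    where
    pqr : profile p q r ≡ t
    pqr = hom p<q q<r p∈ q∈ r∈
    pqs : profile p q s ≡ t
    pqs = hom p<q q<s p∈ q∈ s∈
    qrs : profile q r s ≡ t
    qrs = hom q<r r<s q∈ r∈ s∈

  first≡third⇒¬homogeneous₆ : {t : Profile} {P : Fin m → Set} →
    Homogeneous t P → first t ≡ third t → {a b c d e f : Fin m} →
    AllPairs _<_ (a ∷ b ∷ c ∷ d ∷ e ∷ f ∷ []) → ¬ All P (a ∷ b ∷ c ∷ d ∷ e ∷ f ∷ [])
  first≡third⇒¬homogeneous₆ hom t₁≡t₃
    ( (a<b ∷ a<c ∷ a<d ∷ a<e ∷ a<f ∷ []) ∷ (b<c ∷ b<d ∷ b<e ∷ b<f ∷ []) ∷ (c<d ∷ c<e ∷ c<f ∷ [])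
    ∷ (d<e ∷ d<f ∷ []) ∷ (e<f ∷ []) ∷ [] ∷ [])
    (a∈ ∷ b∈ ∷ c∈ ∷ d∈ ∷ e∈ ∷ f∈ ∷ []) =
    V-¬Clash3 a<b c<d e<f
      (V-≢ˡ a<b c<d (<⇒≢ a<c) (<⇒≢ a<d)) (V-≢ˡ a<b e<f (<⇒≢ a<e) (<⇒≢ a<f))
      (V-≢ˡ c<d e<f (<⇒≢ c<e) (<⇒≢ c<f))
      (matching⇒Clash3 (V-vanishes a<b) (V-vanishes c<d) (V-vanishes e<f)
        (trans (cong first (hom a<c c<d a∈ c∈ d∈))
               (sym (cong first (hom a<e e<f a∈ e∈ f∈))))
        (trans (cong first (hom b<c c<d b∈ c∈ d∈))
               (sym (cong first (hom b<e e<f b∈ e∈ f∈))))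
        (trans (cong third (hom a<b b<c a∈ b∈ c∈))
               (trans (sym t₁≡t₃) (sym (cong first (hom c<e e<f c∈ e∈ f∈)))))
        (trans (cong third (hom a<b b<d a∈ b∈ d∈))
               (trans (sym t₁≡t₃) (sym (cong first (hom d<e e<f d∈ e∈ f∈)))))
        (trans (cong third (hom a<b b<e a∈ b∈ e∈))
               (sym (cong third (hom c<d d<e c∈ d∈ e∈))))
        (trans (cong third (hom a<b b<f a∈ b∈ f∈))
               (sym (cong third (hom c<d d<f c∈ d∈ f∈)))))

  module _ {R : ℕ} (R≤m : R ≤ m) where

    ι : Fin R → Fin m
    ι i = inject≤ i R≤m

    ι-mono : {i j : Fin R} → i < j → ι i < ι j
    ι-mono {i} {j} i<j rewrite toℕ-inject≤ i R≤m | toℕ-inject≤ j R≤m = i<j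

    ι-reflects : {i j : Fin R} → ι i < ι j → i < j
    ι-reflects {i} {j} ιi<ιj rewrite toℕ-inject≤ i R≤m | toℕ-inject≤ j R≤m = ιi<ιj

    χ : Colouring R 8
    χ = onSortedTriples λ x y z → code (profile (ι x) (ι y) (ι z))

    Image : Subset R → Fin m → Set
    Image T x = ∃ λ i → i ∈ T × ι i ≡ x

    monochromatic⇒homogeneous : {i : Fin 8} {T : Subset R} → Monochromatic 3 χ i T →
      Homogeneous (decode i) (Image T)
    monochromatic⇒homogeneous mono x<y y<z (_ , x∈T , refl) (_ , y∈T , refl) (_ , z∈T , refl) =
      trans (sym (decode-code-profile x<y y<z))
        (cong decode (onSortedTriples-monochromatic mono
          (ι-reflects x<y) (ι-reflects y<z) x∈T y∈T z∈T))

    enumerateImage : (T : Subset R) → ∣ T ∣ ≡ k →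
      Σ[ xs ∈ Vec (Fin R) k ] AllPairs _<_ (map ι (toList xs)) × All (Image T) (map ι (toList xs))
    enumerateImage T ∣T∣≡k with enumerate T ∣T∣≡k
    ... | xs , sorted , members =
      xs , AllPairs.map⁺ (AllPairs.map ι-mono sorted)
         , All.map⁺ (All.map (λ i∈T → _ , i∈T , refl) members)

    ¬monochromatic₄ : {i : Fin 8} {T : Subset R} →
      first (decode i) ≡ second (decode i) ⊎ second (decode i) ≡ third (decode i) →
      ∣ T ∣ ≡ 4 → ¬ Monochromatic 3 χ i T
    ¬monochromatic₄ {T = T} shape ∣T∣≡4 mono with enumerateImage T ∣T∣≡4
    ... | _ ∷ _ ∷ _ ∷ _ ∷ [] , sorted , members with shape
    ... | inj₁ t₁≡t₂ = first≡second⇒¬homogeneous₄ (monochromatic⇒homogeneous mono) t₁≡t₂ sorted members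
    ... | inj₂ t₂≡t₃ = second≡third⇒¬homogeneous₄ (monochromatic⇒homogeneous mono) t₂≡t₃ sorted members

    ¬monochromatic₆ : {i : Fin 8} {T : Subset R} → first (decode i) ≡ third (decode i) →
      ∣ T ∣ ≡ 6 → ¬ Monochromatic 3 χ i T
    ¬monochromatic₆ {T = T} t₁≡t₃ ∣T∣≡6 mono with enumerateImage T ∣T∣≡6
    ... | _ ∷ _ ∷ _ ∷ _ ∷ _ ∷ _ ∷ [] , sorted , members =
      first≡third⇒¬homogeneous₆ (monochromatic⇒homogeneous mono) t₁≡t₃ sorted members

    ¬RamseyProperty : ¬ RamseyProperty 3 (4 ∷ 4 ∷ 4 ∷ 4 ∷ 4 ∷ 4 ∷ 6 ∷ 6 ∷ []) R
    ¬RamseyProperty ramsey with ramsey χ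
    ... | zero                                         , _ , sz , mono = ¬monochromatic₄ (inj₁ refl) sz mono
    ... | suc zero                                     , _ , sz , mono = ¬monochromatic₄ (inj₁ refl) sz mono
    ... | suc (suc zero)                               , _ , sz , mono = ¬monochromatic₄ (inj₁ refl) sz mono
    ... | suc (suc (suc zero))                         , _ , sz , mono = ¬monochromatic₄ (inj₁ refl) sz mono
    ... | suc (suc (suc (suc zero)))                   , _ , sz , mono = ¬monochromatic₄ (inj₂ refl) sz mono
    ... | suc (suc (suc (suc (suc zero))))             , _ , sz , mono = ¬monochromatic₄ (inj₂ refl) sz mono
    ... | suc (suc (suc (suc (suc (suc zero)))))       , _ , sz , mono = ¬monochromatic₆ refl sz mono
    ... | suc (suc (suc (suc (suc (suc (suc zero)))))) , _ , sz , mono = ¬monochromatic₆ refl sz mono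

corollary8 : (m R : ℕ)
    → IsRamseyNumber 3 (4 ∷ 4 ∷ 4 ∷ 4 ∷ 4 ∷ 4 ∷ 6 ∷ 6 ∷ []) R
    → m ≥ R
    → ¬ (∃ λ (A : TernSet m) → IsI m (m ∸ 2) A × Admissible A)
corollary8 m R (ramsey , _) m≥R (A , isI , admissible) = ¬RamseyProperty isI admissible m≥R ramsey
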